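{- Fix an integer $n\ge0$. For each $i\in\{0,1,\dots,n\}$ and each $x\in\{0,1,\dots,i\}$, \[F(x,i-x)=2^{n-i}\binom{i}{x}.\]
   Context: For a fixed integer $n\ge0$, define $F:\mathbb{Z}^2\to\mathbb{Z}_{\ge0}$ by $F(0,0)=2^n$, $F(x,y)=\lfloor F(x-1,y)/2\rfloor+\lfloor F(x,y-1)/2\rfloor$ for every $(x,y)\in\mathbb{Z}_{\ge0}^2\setminus\{(0,0)\}$, and $F(x,y)=0$ for $(x,y)$ outside the first quadrant. This is the intermediate firing configuration of chip-firing on the quadrant lattice graph (vertices $\mathbb{Z}_{\ge0}^2$, edges $(x,y)\to(x+1,y)$, $(x,y)\to(x,y+1)$; a vertex with at least 2 chips fires one chip to each out-neighbour) started with $2^n$ chips at the origin and fired row by row: $F(x,y)$ is the number of chips at $(x,y)$ after all rows $x'+y'<x+y$ have been fully fired. -}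

module Defs where

open import Data.Nat using (ℕ; zero; suc; _+_; _^_; _/_)

-- F n x y  is  F(x,y)  for the initial configuration of 2^n chips at the origin,
-- on the first quadrant Z_{≥0}^2.  Values outside the quadrant are 0, so the
-- boundary cases drop the corresponding (zero) term:  ⌊0/2⌋ = 0.
F : ℕ → ℕ → ℕ → ℕ
F n zero    zero    = 2 ^ n
F n (suc x) zero    = F n x zero / 2 + 0
F n zero    (suc y) = 0 + F n zero y / 2
F n (suc x) (suc y) = F n x (suc y) / 2 + F n (suc x) y / 2

{-# OPTIONS --safe #-}
module Submission where

-- Row i ≤ n of F is 2 ^ (n ∸ i) times row i of Pascal's triangle: inductively the
-- entries of row i − 1 are multiples of 2 ^ (n ∸ i + 1), so the floors ⌊·/2⌋ in the
-- recursion are exact halvings and the recursion reduces to Pascal's rule.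

open import Defs
open import Data.Nat using (ℕ; zero; suc; _+_; _*_; _∸_; _^_; _≤_; _/_)
open import Data.Nat.Properties
  using (+-identityʳ; +-suc; *-identityʳ; *-assoc; *-comm; *-distribˡ-+; m+[n∸m]≡n)
open import Data.Nat.DivMod using (m*n/n≡m)
open import Data.Nat.Combinatorics using (_C_; nCn≡1; nCk+nC[k+1]≡[n+1]C[k+1])
open import Relation.Binary.PropositionalEquality
  using (_≡_; refl; sym; trans; cong; cong₂; module ≡-Reasoning)

2^[1+k]*c/2≡2^k*c : ∀ k c → 2 ^ suc k * c / 2 ≡ 2 ^ k * c
2^[1+k]*c/2≡2^k*c k c = begin
  2 * 2 ^ k * c / 2    ≡⟨ cong (_/ 2) (*-assoc 2 (2 ^ k) c) ⟩
  2 * (2 ^ k * c) / 2  ≡⟨ cong (_/ 2) (*-comm 2 (2 ^ k * c)) ⟩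
  2 ^ k * c * 2 / 2    ≡⟨ m*n/n≡m (2 ^ k * c) 2 ⟩
  2 ^ k * c            ∎
  where open ≡-Reasoning

[m+0]Cm≡1 : ∀ m → (m + 0) C m ≡ 1
[m+0]Cm≡1 m = trans (cong (_C m) (+-identityʳ m)) (nCn≡1 m)

F≡2^k*[x+y]Cx : ∀ {n} x y k → x + y + k ≡ n → F n x y ≡ 2 ^ k * ((x + y) C x)
F≡2^k*[x+y]Cx zero zero k refl = sym (*-identityʳ (2 ^ k))
F≡2^k*[x+y]Cx {n} (suc x) zero k eq = begin
  F n x 0 / 2 + 0                ≡⟨ +-identityʳ _ ⟩
  F n x 0 / 2                    ≡⟨ cong (_/ 2) (F≡2^k*[x+y]Cx x 0 (suc k) (trans (+-suc (x + 0) k) eq)) ⟩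
  2 ^ suc k * ((x + 0) C x) / 2  ≡⟨ 2^[1+k]*c/2≡2^k*c k _ ⟩
  2 ^ k * ((x + 0) C x)          ≡⟨ cong (2 ^ k *_) (trans ([m+0]Cm≡1 x) (sym ([m+0]Cm≡1 (suc x)))) ⟩
  2 ^ k * ((suc x + 0) C suc x)  ∎
  where open ≡-Reasoning
F≡2^k*[x+y]Cx {n} zero (suc y) k eq = begin
  F n 0 y / 2                    ≡⟨ cong (_/ 2) (F≡2^k*[x+y]Cx 0 y (suc k) (trans (+-suc y k) eq)) ⟩
  2 ^ suc k * 1 / 2              ≡⟨ 2^[1+k]*c/2≡2^k*c k 1 ⟩
  2 ^ k * 1                      ∎
  where open ≡-Reasoning
F≡2^k*[x+y]Cx {n} (suc x) (suc y) k eq = begin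
  F n x (suc y) / 2 + F n (suc x) y / 2
    ≡⟨ cong₂ (λ a b → a / 2 + b / 2) (F≡2^k*[x+y]Cx x (suc y) (suc k) left)
                                     (F≡2^k*[x+y]Cx (suc x) y (suc k) right) ⟩
  2 ^ suc k * (m C x) / 2 + 2 ^ suc k * ((suc x + y) C suc x) / 2
    ≡⟨ cong₂ _+_ (2^[1+k]*c/2≡2^k*c k _) (2^[1+k]*c/2≡2^k*c k _) ⟩
  2 ^ k * (m C x) + 2 ^ k * (suc (x + y) C suc x)
    ≡⟨ cong (λ j → 2 ^ k * (m C x) + 2 ^ k * (j C suc x)) (sym (+-suc x y)) ⟩
  2 ^ k * (m C x) + 2 ^ k * (m C suc x)
    ≡⟨ sym (*-distribˡ-+ (2 ^ k) (m C x) (m C suc x)) ⟩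
  2 ^ k * (m C x + m C suc x)
    ≡⟨ cong (2 ^ k *_) (nCk+nC[k+1]≡[n+1]C[k+1] m x) ⟩
  2 ^ k * (suc m C suc x)
    ∎
  where
  open ≡-Reasoning
  m : ℕ
  m = x + suc y
  left : m + suc k ≡ n
  left = trans (+-suc m k) eq
  right : suc x + y + suc k ≡ n
  right = trans (+-suc (suc x + y) k) (trans (cong (λ j → suc j + k) (sym (+-suc x y))) eq)

proposition5p1 : (n i x : ℕ) → i ≤ n → x ≤ i →
    F n x (i ∸ x) ≡ 2 ^ (n ∸ i) * (i C x)
proposition5p1 n i x i≤n x≤i = begin
  F n x (i ∸ x)                       ≡⟨ F≡2^k*[x+y]Cx x (i ∸ x) (n ∸ i) x+y+k≡n ⟩
  2 ^ (n ∸ i) * ((x + (i ∸ x)) C x)   ≡⟨ cong (λ j → 2 ^ (n ∸ i) * (j C x)) (m+[n∸m]≡n x≤i) ⟩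
  2 ^ (n ∸ i) * (i C x)               ∎
  where
  open ≡-Reasoning
  x+y+k≡n : x + (i ∸ x) + (n ∸ i) ≡ n
  x+y+k≡n = trans (cong (_+ (n ∸ i)) (m+[n∸m]≡n x≤i)) (m+[n∸m]≡n i≤n)
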